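{- There is a sentence of flip-connectivity logic that holds in a graph $G$ if and only if the complement of $G$ is connected. However, there is no sentence of separator logic with this property.
   Context: Graphs are finite, simple, undirected. Separator logic: first-order logic over graphs with predicates $\mathrm{conn}_k(s,t,a_1,\dots,a_k)$ for each $k$, holding iff there is a path with endpoints $s,t$ avoiding $a_1,\dots,a_k$. Atomic type $\mathrm{atp}(v_1,\dots,v_k)$: set of atomic formulas $x_i=x_j$, $E(x_i,x_j)$, $U(x_i)$ satisfied by the tuple; $\mathrm{atp}^k$: set of all atomic types of $k$-tuples. For symmetric $A\subseteq\mathrm{atp}^{k+1}\times\mathrm{atp}^{k+1}$ and $\bar a\in V(G)^k$, $G\oplus_{\bar a}A$ is the graph on $V(G)$ where distinct $u,v$ are adjacent iff $[uv\in E(G)]$ xor $[(\mathrm{atp}(u,\bar a),\mathrm{atp}(v,\bar a))\in A]$. Flip-connectivity logic: first-order logic with predicates $\mathrm{flipconn}_{k,A}(s,t,\bar a)$ holding iff $s,t$ are in the same connected component of $G\oplus_{\bar a}A$. -}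

module Defs where

open import Data.Nat using (ℕ; zero; suc)
open import Data.Fin using (Fin; zero; suc; _≟_)
open import Data.Bool using (Bool; true; false; not; if_then_else_; _xor_; _∧_; T)
open import Data.Product using (Σ; _×_; _,_)
open import Data.Sum using (_⊎_)
open import Relation.Binary.PropositionalEquality using (_≡_)
open import Relation.Nullary using (¬_)
open import Relation.Nullary.Decidable using (⌊_⌋)

record Graph : Set where
  field
    n          : ℕ
    adj        : Fin n → Fin n → Bool
    adj-sym    : ∀ u v → adj u v ≡ adj v u
    adj-irrefl : ∀ v → adj v v ≡ false

V : Graph → Set
V G = Fin (Graph.n G)

-- Walks inside the vertex set {v | ok v}, along the adjacency R.
-- (Existence of such a walk is equivalent to existence of a path.)
data Walk {n : ℕ} (R : Fin n → Fin n → Bool) (ok : Fin n → Bool) : Fin n → Fin n → Set where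
  here : ∀ {s} → T (ok s) → Walk R ok s s
  step : ∀ {s u t} → T (ok s) → T (R s u) → Walk R ok u t → Walk R ok s t

everywhere : {n : ℕ} → Fin n → Bool
everywhere _ = true

SameComponent : {n : ℕ} → (Fin n → Fin n → Bool) → Fin n → Fin n → Set
SameComponent R s t = Walk R everywhere s t

Connected : {n : ℕ} → (Fin n → Fin n → Bool) → Set
Connected R = ∀ s t → SameComponent R s t

complementAdj : (G : Graph) → V G → V G → Bool
complementAdj G u v = if ⌊ u ≟ v ⌋ then false else not (Graph.adj G u v)

ComplementConnected : Graph → Set
ComplementConnected G = Connected (complementAdj G)

cons : {A : Set} {k : ℕ} → A → (Fin k → A) → Fin (suc k) → A
cons x a zero    = x
cons x a (suc i) = a i

notIn : {n k : ℕ} → (Fin k → Fin n) → Fin n → Bool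
notIn {k = zero}  a v = true
notIn {k = suc k} a v = not ⌊ a zero ≟ v ⌋ ∧ notIn (λ i → a (suc i)) v

-- Atomic types of (k+1)-tuples: for each pair (i , j) of positions,
-- whether x_i = x_j holds and whether E(x_i , x_j) holds.

Atp : ℕ → Set
Atp k = Fin (suc k) → Fin (suc k) → Bool × Bool

atp : (G : Graph) {k : ℕ} → (Fin (suc k) → V G) → Atp k
atp G w i j = ⌊ w i ≟ w j ⌋ , Graph.adj G (w i) (w j)

record FlipRel (k : ℕ) : Set where
  field
    rel     : Atp k → Atp k → Bool
    rel-sym : ∀ t t' → rel t t' ≡ rel t' t

flipAdj : (G : Graph) {k : ℕ} → FlipRel k → (Fin k → V G) → V G → V G → Bool
flipAdj G A a u v =
  if ⌊ u ≟ v ⌋ then false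
  else (Graph.adj G u v xor FlipRel.rel A (atp G (cons u a)) (atp G (cons v a)))

-- First-order logic over graphs with extra atoms, de Bruijn variables

module FOL (At : ℕ → Set)
           (interp : {m : ℕ} (G : Graph) → At m → (Fin m → V G) → Set) where

  data Formula (m : ℕ) : Set where
    equal : Fin m → Fin m → Formula m
    edge  : Fin m → Fin m → Formula m
    atom  : At m → Formula m
    neg   : Formula m → Formula m
    and   : Formula m → Formula m → Formula m
    or    : Formula m → Formula m → Formula m
    ex    : Formula (suc m) → Formula m
    all   : Formula (suc m) → Formula m

  Sat : {m : ℕ} (G : Graph) → Formula m → (Fin m → V G) → Set
  Sat G (equal i j) ρ = ρ i ≡ ρ j
  Sat G (edge i j)  ρ = T (Graph.adj G (ρ i) (ρ j))
  Sat G (atom a)    ρ = interp G a ρ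
  Sat G (neg φ)     ρ = ¬ Sat G φ ρ
  Sat G (and φ ψ)   ρ = Sat G φ ρ × Sat G ψ ρ
  Sat G (or φ ψ)    ρ = Sat G φ ρ ⊎ Sat G ψ ρ
  Sat G (ex φ)      ρ = Σ (V G) (λ v → Sat G φ (cons v ρ))
  Sat G (all φ)     ρ = (v : V G) → Sat G φ (cons v ρ)

  Sentence : Set
  Sentence = Formula zero

  empty : (G : Graph) → Fin zero → V G
  empty G ()

  _⊨_ : Graph → Sentence → Set
  G ⊨ φ = Sat G φ (empty G)

data SepAtom (m : ℕ) : Set where
  conn : (k : ℕ) → Fin m → Fin m → (Fin k → Fin m) → SepAtom m

⟦sep⟧ : {m : ℕ} (G : Graph) → SepAtom m → (Fin m → V G) → Set
⟦sep⟧ G (conn k s t a) ρ =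
  Walk (Graph.adj G) (notIn (λ i → ρ (a i))) (ρ s) (ρ t)

module Sep = FOL SepAtom ⟦sep⟧

data FlipAtom (m : ℕ) : Set where
  flipconn : (k : ℕ) → FlipRel k → Fin m → Fin m → (Fin k → Fin m) → FlipAtom m

⟦flip⟧ : {m : ℕ} (G : Graph) → FlipAtom m → (Fin m → V G) → Set
⟦flip⟧ G (flipconn k A s t a) ρ =
  SameComponent (flipAdj G A (λ i → ρ (a i))) (ρ s) (ρ t)

module Flip = FOL FlipAtom ⟦flip⟧

{-# OPTIONS --safe #-}
-- The complement of G is G ⊕ A for the flip A that toggles every pair of vertices, so a single
-- flipconn atom with no parameters, universally quantified, expresses complement connectivity.
--
-- Separator logic cannot: compare the complements G₁ and G₂ of the circulant graphs on ℤ/N with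
-- jumps ±1 (one N-cycle) and ±2 (two cycles, N even).  Both are so dense that conn(s, t, ā) only
-- says that s and t avoid ā, so on them separator logic is first-order logic with equality and
-- edges.  A sentence of quantifier rank Q cannot separate them once N is large: with r rounds left,
-- Duplicator keeps the chosen points at the same displacements (counted in jumps, modulo N) up to
-- 2^r, answering a point near an earlier one by the point at the same displacement and a far point
-- by a far point.
module Submission where

open import Defs
open import Data.Bool using (Bool; true; false; not; if_then_else_; T)
open import Data.Bool.Properties using (not-involutive; xor-comm; true-xor)
open import Data.Empty using (⊥-elim)
open import Data.Fin using (Fin; zero; suc; _≟_; toℕ; fromℕ<)
import Data.Fin.Properties as Finₚ
open import Data.Integer as ℤ using (ℤ; +_; -[1+_]; ∣_∣)
open import Data.Integer.Divisibility.Signed as ℤ∣ using (divides; _∣?_) renaming (_∣_ to _∣ℤ_)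
open import Data.Integer.DivMod using (_%ℕ_; _/ℕ_; a≡a%ℕn+[a/ℕn]*n; n%ℕd<d)
import Data.Integer.Properties as ℤₚ
open import Data.Integer.Tactic.RingSolver using (solve-∀)
open import Data.List using (List; []; _∷_; _++_; map; length)
open import Data.List.Membership.Propositional using (_∈_; _∉_)
open import Data.List.Membership.Propositional.Properties using (∈-map⁺; ∈-map⁻; ∈-++⁺ˡ; ∈-++⁺ʳ; ∈-++⁻)
import Data.List.Membership.DecPropositional as DecMembership
import Data.List.Properties as Listₚ
import Data.List.Relation.Unary.Any as Any
open import Data.List.Relation.Unary.Any using (here; there)
import Data.List.Relation.Unary.Any.Properties as Anyₚ
open import Data.Nat using (ℕ; zero; suc; _+_; _*_; _^_; _≤_; _<_; _⊔_; z≤n; s≤s; NonZero)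
open import Data.Nat.Divisibility as ℕ∣ using ()
import Data.Nat.Properties as ℕₚ
open import Data.Product using (Σ; ∃; _×_; _,_; proj₁; proj₂)
open import Data.Product.Function.NonDependent.Propositional using (_×-⇔_)
open import Data.Sum using (_⊎_; inj₁; inj₂)
open import Data.Sum.Function.Propositional using (_⊎-⇔_)
open import Data.Unit using (tt)
open import Function using (_∘_)
open import Function.Bundles using (_⇔_; mk⇔; Equivalence)
import Function.Properties.Equivalence as ⇔
open import Function.Related.TypeIsomorphisms using (¬-cong-⇔)
open import Relation.Binary.PropositionalEquality
open import Relation.Nullary using (¬_; Dec; yes; no; ¬?)
open import Relation.Nullary.Decidable using (⌊_⌋; decidable-stable; map′; _⊎-dec_; toWitness; fromWitness)

open Equivalence using (to; from)

module _ {n : ℕ} where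
  open DecMembership (Finₚ._≟_ {n}) using (_∈?_)

  fresh : (l : List (Fin n)) → length l < n → ∃ λ w → w ∉ l
  fresh l l<n with Finₚ.any? (λ w → ¬? (w ∈? l))
  ... | yes w∉l = w∉l
  ... | no ¬w∉l = ⊥-elim (ℕₚ.<⇒≱ l<n (Finₚ.injective⇒≤ index-injective))
    where
    ∈l : ∀ w → w ∈ l
    ∈l w = decidable-stable (w ∈? l) (λ w∉ → ¬w∉l (w , w∉))
    index-injective : ∀ {x y} → Any.index (∈l x) ≡ Any.index (∈l y) → x ≡ y
    index-injective {x} {y} eq = trans (Anyₚ.lookup-index (∈l x))
      (trans (cong (Data.List.lookup l) eq) (sym (Anyₚ.lookup-index (∈l y))))

T-not : ∀ {b} → T (not b) ⇔ (¬ T b)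
T-not {false} = mk⇔ (λ _ ()) (λ _ → tt)
T-not {true}  = mk⇔ (λ ()) (λ ¬tt → ¬tt tt)

T-⇔⇒≡ : ∀ {a b} → T a ⇔ T b → a ≡ b
T-⇔⇒≡ {false} {false} _   = refl
T-⇔⇒≡ {false} {true}  a⇔b = ⊥-elim (from a⇔b tt)
T-⇔⇒≡ {true}  {false} a⇔b = ⊥-elim (to a⇔b tt)
T-⇔⇒≡ {true}  {true}  _   = refl

T-notIn : ∀ {n k} {a : Fin k → Fin n} {v} → T (notIn a v) ⇔ (∀ i → a i ≢ v)
T-notIn {k = zero}          = mk⇔ (λ _ ()) (λ _ → tt)
T-notIn {k = suc k} {a} {v} with a zero ≟ v
... | yes a₀≡v = mk⇔ (λ ()) (λ a≢v → a≢v zero a₀≡v)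
... | no  a₀≢v = mk⇔ (λ tail-avoids → λ { zero → a₀≢v ; (suc i) → to T-notIn tail-avoids i })
                     (λ a≢v → from T-notIn (a≢v ∘ suc))

module _ {n : ℕ} where

  offDiagonal : (Fin n → Fin n → Bool) → Fin n → Fin n → Bool
  offDiagonal R u v = if ⌊ u ≟ v ⌋ then false else R u v

  T-offDiagonal : ∀ {R u v} → T (offDiagonal R u v) ⇔ (u ≢ v × T (R u v))
  T-offDiagonal {R} {u} {v} with u ≟ v
  ... | yes u≡v = mk⇔ (λ ()) (λ (u≢v , _) → u≢v u≡v)
  ... | no  u≢v = mk⇔ (u≢v ,_) proj₂

simpleGraph : (n : ℕ) (R : Fin n → Fin n → Bool) → (∀ u v → R u v ≡ R v u) → Graph
simpleGraph n R R-sym = record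
  { n          = n
  ; adj        = offDiagonal R
  ; adj-sym    = λ u v → T-⇔⇒≡ (mk⇔ (swap-edge u v) (swap-edge v u))
  ; adj-irrefl = λ v → T-⇔⇒≡ (mk⇔ (λ e → proj₁ (to (T-offDiagonal {R = R}) e) refl) λ ())
  }
  where
  swap-edge : ∀ u v → T (offDiagonal R u v) → T (offDiagonal R v u)
  swap-edge u v e with to (T-offDiagonal {R = R}) e
  ... | u≢v , Ruv = from (T-offDiagonal {R = R}) (u≢v ∘ sym , subst T (R-sym u v) Ruv)

complement : Graph → Graph
complement G =
  simpleGraph (Graph.n G) (λ u v → not (Graph.adj G u v)) (λ u v → cong not (Graph.adj-sym G u v))

T-complement : ∀ {G u v} → T (Graph.adj (complement G) u v) ⇔ (u ≢ v × ¬ T (Graph.adj G u v))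
T-complement {G} = ⇔.trans (T-offDiagonal {R = λ u v → not (Graph.adj G u v)}) (⇔.refl ×-⇔ T-not)

complementAdj-complement : ∀ G u v → complementAdj (complement G) u v ≡ Graph.adj G u v
complementAdj-complement G u v with u ≟ v
... | yes refl = sym (Graph.adj-irrefl G u)
... | no  _    = not-involutive (Graph.adj G u v)

Walk-map : ∀ {n} {R R′ : Fin n → Fin n → Bool} → (∀ {u v} → T (R u v) → T (R′ u v)) →
           ∀ {ok s t} → Walk R ok s t → Walk R′ ok s t
Walk-map R⊆R′ (here ok-s)      = here ok-s
Walk-map R⊆R′ (step ok-s e w) = step ok-s (R⊆R′ e) (Walk-map R⊆R′ w)

Walk-cong : ∀ {n} {R R′ : Fin n → Fin n → Bool} → (∀ u v → R u v ≡ R′ u v) →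
            ∀ {ok s t} → Walk R ok s t ⇔ Walk R′ ok s t
Walk-cong R≡R′ = mk⇔ (Walk-map (λ {u} {v} → subst T (R≡R′ u v)))
                     (Walk-map (λ {u} {v} → subst T (sym (R≡R′ u v))))

Connected-cong : ∀ {n} {R R′ : Fin n → Fin n → Bool} → (∀ u v → R u v ≡ R′ u v) →
                 Connected R ⇔ Connected R′
Connected-cong R≡R′ = mk⇔ (λ c s t → to (Walk-cong R≡R′) (c s t))
                          (λ c s t → from (Walk-cong R≡R′) (c s t))

Walk-endpoints : ∀ {n} {R ok} {s t : Fin n} → Walk R ok s t → T (ok s) × T (ok t)
Walk-endpoints (here ok-s)      = ok-s , ok-s
Walk-endpoints (step ok-s _ w) = ok-s , proj₂ (Walk-endpoints w)

ComplementConnected-complement : ∀ G → ComplementConnected (complement G) ⇔ Connected (Graph.adj G)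
ComplementConnected-complement G = Connected-cong (complementAdj-complement G)

complementFlip : FlipRel 0
complementFlip = record { rel = λ _ _ → true ; rel-sym = λ _ _ → refl }

flipAdj-complementFlip : ∀ G ā u v → flipAdj G complementFlip ā u v ≡ complementAdj G u v
flipAdj-complementFlip G ā u v with u ≟ v
... | yes _ = refl
... | no  _ = trans (xor-comm (Graph.adj G u v) true) (true-xor (Graph.adj G u v))

noVariables : Fin 0 → Fin 2
noVariables ()

complementConnectedSentence : Flip.Sentence
complementConnectedSentence =
  Flip.all (Flip.all (Flip.atom (flipconn 0 complementFlip (suc zero) zero noVariables)))

complementConnectedSentence-correct : ∀ G → (G Flip.⊨ complementConnectedSentence) ⇔ ComplementConnected G
complementConnectedSentence-correct G = mk⇔
  (λ sat s t → to (Walk-cong (flipAdj-complementFlip G (ā s t))) (sat s t))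
  (λ conn s t → from (Walk-cong (flipAdj-complementFlip G (ā s t))) (conn s t))
  where
  -- the (empty) parameter tuple of the atom under the assignment s, t; it is not definitionally λ ()
  ā : V G → V G → Fin 0 → V G
  ā s t i = cons t (cons s (Flip.empty G)) (noVariables i)

module EhrenfeuchtFraisse (At : ℕ → Set)
                         (interp : {m : ℕ} (G : Graph) → At m → (Fin m → V G) → Set) where
  open FOL At interp

  quantifierRank : ∀ {m} → Formula m → ℕ
  quantifierRank (equal _ _) = 0
  quantifierRank (edge _ _)  = 0
  quantifierRank (atom _)    = 0
  quantifierRank (neg φ)     = quantifierRank φ
  quantifierRank (and φ ψ)   = quantifierRank φ ⊔ quantifierRank ψ
  quantifierRank (or φ ψ)    = quantifierRank φ ⊔ quantifierRank ψ
  quantifierRank (ex φ)      = suc (quantifierRank φ)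
  quantifierRank (all φ)     = suc (quantifierRank φ)

  record BackAndForth (G H : Graph) : Set₁ where
    field
      Related : ℕ → ∀ {m} → (Fin m → V G) → (Fin m → V H) → Set
      equal-⇔ : ∀ {r m ρ σ} → Related r {m} ρ σ → ∀ i j → (ρ i ≡ ρ j) ⇔ (σ i ≡ σ j)
      edge-⇔  : ∀ {r m ρ σ} → Related r {m} ρ σ → ∀ i j →
                T (Graph.adj G (ρ i) (ρ j)) ⇔ T (Graph.adj H (σ i) (σ j))
      atom-⇔  : ∀ {r m ρ σ} → Related r {m} ρ σ → ∀ a → interp G a ρ ⇔ interp H a σ
      forth   : ∀ {r m ρ σ} → Related (suc r) {m} ρ σ → ∀ v → ∃ λ w → Related r (cons v ρ) (cons w σ)
      back    : ∀ {r m ρ σ} → Related (suc r) {m} ρ σ → ∀ w → ∃ λ v → Related r (cons v ρ) (cons w σ)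

    Sat-⇔ : ∀ {r m ρ σ} → Related r {m} ρ σ → (φ : Formula m) → quantifierRank φ ≤ r →
            Sat G φ ρ ⇔ Sat H φ σ
    Sat-⇔ rel (equal i j) _ = equal-⇔ rel i j
    Sat-⇔ rel (edge i j)  _ = edge-⇔ rel i j
    Sat-⇔ rel (atom a)    _ = atom-⇔ rel a
    Sat-⇔ rel (neg φ)   φ≤r = ¬-cong-⇔ (Sat-⇔ rel φ φ≤r)
    Sat-⇔ rel (and φ ψ) φψ≤r =
      Sat-⇔ rel φ (ℕₚ.m⊔n≤o⇒m≤o _ _ φψ≤r) ×-⇔ Sat-⇔ rel ψ (ℕₚ.m⊔n≤o⇒n≤o _ _ φψ≤r)
    Sat-⇔ rel (or φ ψ)  φψ≤r =
      Sat-⇔ rel φ (ℕₚ.m⊔n≤o⇒m≤o _ _ φψ≤r) ⊎-⇔ Sat-⇔ rel ψ (ℕₚ.m⊔n≤o⇒n≤o _ _ φψ≤r)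
    Sat-⇔ rel (ex φ) (s≤s φ≤r) = mk⇔
      (λ (v , sat) → let w , rel′ = forth rel v in w , to (Sat-⇔ rel′ φ φ≤r) sat)
      (λ (w , sat) → let v , rel′ = back rel w in v , from (Sat-⇔ rel′ φ φ≤r) sat)
    Sat-⇔ rel (all φ) (s≤s φ≤r) = mk⇔
      (λ sat w → let v , rel′ = back rel w in to (Sat-⇔ rel′ φ φ≤r) (sat v))
      (λ sat v → let w , rel′ = forth rel v in from (Sat-⇔ rel′ φ φ≤r) (sat w))

module SepEF = EhrenfeuchtFraisse SepAtom ⟦sep⟧

∣i∣<n⇒n∣i⇒i≡0 : ∀ {n} i → ∣ i ∣ < n → + n ∣ℤ i → i ≡ + 0
∣i∣<n⇒n∣i⇒i≡0 i ∣i∣<n n∣i with ∣ i ∣ in ∣i∣≡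
... | zero  = ℤₚ.∣i∣≡0⇒i≡0 ∣i∣≡
... | suc _ = ⊥-elim (ℕ∣.>⇒∤ ∣i∣<n (subst (_ ℕ∣.∣_) ∣i∣≡ (ℤ∣.∣⇒∣ᵤ n∣i)))

symRange : ℕ → List ℤ
symRange zero    = + 0 ∷ []
symRange (suc D) = + suc D ∷ -[1+ D ] ∷ symRange D

length-symRange : ∀ D → length (symRange D) ≡ suc (2 * D)
length-symRange zero    = refl
length-symRange (suc D) = cong (λ n → 2 + n) (trans (length-symRange D) (sym (ℕₚ.+-suc D (D + 0))))

∈-symRange⁺ : ∀ {D e} → ∣ e ∣ ≤ D → e ∈ symRange D
∈-symRange⁺ {zero}  ∣e∣≤0 = here (ℤₚ.∣i∣≡0⇒i≡0 (ℕₚ.n≤0⇒n≡0 ∣e∣≤0))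
∈-symRange⁺ {suc D} {+ n} ∣e∣≤1+D with ℕₚ.m≤n⇒m<n∨m≡n ∣e∣≤1+D
... | inj₁ (s≤s ∣e∣≤D) = there (there (∈-symRange⁺ ∣e∣≤D))
... | inj₂ refl        = here refl
∈-symRange⁺ {suc D} { -[1+ n ]} (s≤s n≤D) with ℕₚ.m≤n⇒m<n∨m≡n n≤D
... | inj₁ n<D = there (there (∈-symRange⁺ n<D))
... | inj₂ refl = there (here refl)

∈-symRange⁻ : ∀ {D e} → e ∈ symRange D → ∣ e ∣ ≤ D
∈-symRange⁻ {zero}  (here refl)         = z≤n
∈-symRange⁻ {suc D} (here refl)         = ℕₚ.≤-refl
∈-symRange⁻ {suc D} (there (here refl)) = ℕₚ.≤-refl
∈-symRange⁻ {suc D} (there (there e∈))  = ℕₚ.m≤n⇒m≤1+n (∈-symRange⁻ e∈)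

module Circulant (N : ℕ) {{_ : NonZero N}} where
  open DecMembership (Finₚ._≟_ {N}) using (_∈?_)

  ι : Fin N → ℤ
  ι x = + toℕ x

  -- y is reached from x by d jumps of length s around ℤ/N
  record Disp (s : ℕ) (x y : Fin N) (d : ℤ) : Set where
    constructor disp
    field N∣gap : + N ∣ℤ ι y ℤ.- ι x ℤ.- + s ℤ.* d
  open Disp

  module _ {s : ℕ} where

    Disp-refl : ∀ {x} → Disp s x x (+ 0)
    Disp-refl {x} = disp (divides (+ 0) (no-gap (ι x) (+ s) (+ N)))
      where
      no-gap : ∀ X S M → X ℤ.- X ℤ.- S ℤ.* + 0 ≡ + 0 ℤ.* M
      no-gap = solve-∀

    Disp-sym : ∀ {x y d} → Disp s x y d → Disp s y x (ℤ.- d)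
    Disp-sym {x} {y} {d} (disp N∣gap) =
      disp (subst (+ N ∣ℤ_) (negate-gap (ι x) (ι y) (+ s) d) (ℤ∣.∣m⇒∣-m N∣gap))
      where
      negate-gap : ∀ X Y S D → ℤ.- (Y ℤ.- X ℤ.- S ℤ.* D) ≡ X ℤ.- Y ℤ.- S ℤ.* (ℤ.- D)
      negate-gap = solve-∀

    Disp-trans : ∀ {x y z d e} → Disp s x y d → Disp s y z e → Disp s x z (d ℤ.+ e)
    Disp-trans {x} {y} {z} {d} {e} (disp N∣gap₁) (disp N∣gap₂) =
      disp (subst (+ N ∣ℤ_) (add-gaps (ι x) (ι y) (ι z) (+ s) d e) (ℤ∣.∣m∣n⇒∣m+n N∣gap₁ N∣gap₂))
      where
      add-gaps : ∀ X Y Z S D E →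
                 (Y ℤ.- X ℤ.- S ℤ.* D) ℤ.+ (Z ℤ.- Y ℤ.- S ℤ.* E) ≡ Z ℤ.- X ℤ.- S ℤ.* (D ℤ.+ E)
      add-gaps = solve-∀

    Disp-self : ∀ {x y d} → Disp s x x d → Disp s y y d
    Disp-self {x} {y} {d} (disp N∣gap) = disp (subst (+ N ∣ℤ_) (move-base (ι x) (ι y) (+ s) d) N∣gap)
      where
      move-base : ∀ X Y S D → X ℤ.- X ℤ.- S ℤ.* D ≡ Y ℤ.- Y ℤ.- S ℤ.* D
      move-base = solve-∀

    Disp-0⇒≡ : ∀ {x y} → Disp s x y (+ 0) → x ≡ y
    Disp-0⇒≡ {x} {y} (disp N∣gap) = sym (Finₚ.toℕ-injective (ℤₚ.+-injective (ℤₚ.i-j≡0⇒i≡j (ι y) (ι x)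
      (∣i∣<n⇒n∣i⇒i≡0 _ ∣y-x∣<N (subst (+ N ∣ℤ_) (drop-zero (ι x) (ι y) (+ s)) N∣gap)))))
      where
      drop-zero : ∀ X Y S → Y ℤ.- X ℤ.- S ℤ.* + 0 ≡ Y ℤ.- X
      drop-zero = solve-∀
      ∣y-x∣<N : ∣ ι y ℤ.- ι x ∣ < N
      ∣y-x∣<N rewrite ℤₚ.m-n≡m⊖n (toℕ y) (toℕ x) =
        ℕₚ.≤-<-trans (ℤₚ.∣m⊝n∣≤m⊔n (toℕ y) (toℕ x)) (ℕₚ.⊔-pres-<m (Finₚ.toℕ<n y) (Finₚ.toℕ<n x))

    Disp-functional : ∀ {x y z d} → Disp s x y d → Disp s x z d → y ≡ z
    Disp-functional {d = d} x→y x→z =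
      Disp-0⇒≡ (subst (Disp s _ _) (ℤₚ.+-inverseˡ d) (Disp-trans (Disp-sym x→y) x→z))

    Disp-self⇒0 : ∀ {x d} .{{_ : NonZero s}} → s * ∣ d ∣ < N → Disp s x x d → d ≡ + 0
    Disp-self⇒0 {x} {d} s∣d∣<N (disp N∣gap) =
      ℤₚ.∣i∣≡0⇒i≡0 (ℕₚ.m*n≡0⇒m≡0 ∣ d ∣ s (trans (ℕₚ.*-comm ∣ d ∣ s) s∣d∣≡0))
      where
      loop : ∀ X S D → X ℤ.- X ℤ.- S ℤ.* D ≡ ℤ.- (S ℤ.* D)
      loop = solve-∀
      sd≡0 : + s ℤ.* d ≡ + 0
      sd≡0 = ∣i∣<n⇒n∣i⇒i≡0 _ (subst (_< N) (sym (ℤₚ.abs-* (+ s) d)) s∣d∣<N)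
               (subst (+ N ∣ℤ_) (ℤₚ.neg-involutive _)
                      (ℤ∣.∣m⇒∣-m (subst (+ N ∣ℤ_) (loop (ι x) (+ s) d) N∣gap)))
      s∣d∣≡0 : s * ∣ d ∣ ≡ 0
      s∣d∣≡0 = trans (sym (ℤₚ.abs-* (+ s) d)) (cong ∣_∣ sd≡0)

    Disp-self⇔≡0 : ∀ {x d} .{{_ : NonZero s}} → s * ∣ d ∣ < N → Disp s x x d ⇔ d ≡ + 0
    Disp-self⇔≡0 s∣d∣<N = mk⇔ (Disp-self⇒0 s∣d∣<N) (λ { refl → Disp-refl })

    Disp-0⇔≡ : ∀ {x y} → Disp s x y (+ 0) ⇔ (x ≡ y)
    Disp-0⇔≡ = mk⇔ Disp-0⇒≡ (λ { refl → Disp-refl })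

    Disp-sym-⇔ : ∀ {x y d} → Disp s x y d ⇔ Disp s y x (ℤ.- d)
    Disp-sym-⇔ {d = d} = mk⇔ Disp-sym (subst (Disp s _ _) (ℤₚ.neg-involutive d) ∘ Disp-sym)

    Disp-self-⇔ : ∀ {x y d} → Disp s x x d ⇔ Disp s y y d
    Disp-self-⇔ = mk⇔ Disp-self Disp-self

    Disp-via : ∀ {x y v d e} → Disp s x v e → Disp s y v d ⇔ Disp s y x (d ℤ.- e)
    Disp-via {d = d} {e} x→v = mk⇔
      (λ y→v → Disp-trans y→v (Disp-sym x→v))
      (λ y→x → subst (Disp s _ _) (cancel d e) (Disp-trans y→x x→v))
      where
      cancel : ∀ D E → D ℤ.- E ℤ.+ E ≡ D
      cancel = solve-∀

  translate : ℕ → Fin N → ℤ → Fin N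
  translate s x d = fromℕ< (n%ℕd<d (ι x ℤ.+ + s ℤ.* d) N)

  Disp-translate : ∀ s x d → Disp s x (translate s x d) d
  Disp-translate s x d = disp (divides (ℤ.- q) (begin
    ι (translate s x d) ℤ.- ι x ℤ.- + s ℤ.* d
      ≡⟨ cong (λ t → + t ℤ.- ι x ℤ.- + s ℤ.* d) (Finₚ.toℕ-fromℕ< _) ⟩
    r ℤ.- ι x ℤ.- + s ℤ.* d                   ≡⟨ regroup r (ι x) (+ s ℤ.* d) ⟩
    r ℤ.- a                                   ≡⟨ cong (λ b → r ℤ.- b) (a≡a%ℕn+[a/ℕn]*n a N) ⟩
    r ℤ.- (r ℤ.+ q ℤ.* + N)                   ≡⟨ cancel r q (+ N) ⟩
    ℤ.- q ℤ.* + N                             ∎))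
    where
    open ≡-Reasoning
    a r q : ℤ
    a = ι x ℤ.+ + s ℤ.* d
    r = + (a %ℕ N)
    q = a /ℕ N
    regroup : ∀ R X T → R ℤ.- X ℤ.- T ≡ R ℤ.- (X ℤ.+ T)
    regroup = solve-∀
    cancel : ∀ R Q M → R ℤ.- (R ℤ.+ Q ℤ.* M) ≡ ℤ.- Q ℤ.* M
    cancel = solve-∀

  Disp? : ∀ s x y d → Dec (Disp s x y d)
  Disp? s x y d = map′ disp N∣gap (+ N ∣? _)

  ball : ∀ {m} → ℕ → (Fin m → Fin N) → ℕ → List (Fin N)
  ball {zero}  s ρ D = []
  ball {suc m} s ρ D = map (translate s (ρ zero)) (symRange D) ++ ball s (ρ ∘ suc) D

  length-ball : ∀ {m} s (ρ : Fin m → Fin N) D → length (ball s ρ D) ≡ m * suc (2 * D)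
  length-ball {zero}  s ρ D = refl
  length-ball {suc m} s ρ D = begin
    length (map (translate s (ρ zero)) (symRange D) ++ ball s (ρ ∘ suc) D)
      ≡⟨ Listₚ.length-++ (map (translate s (ρ zero)) (symRange D)) ⟩
    length (map (translate s (ρ zero)) (symRange D)) + length (ball s (ρ ∘ suc) D)
      ≡⟨ cong₂ _+_ (trans (Listₚ.length-map _ (symRange D)) (length-symRange D))
                   (length-ball s (ρ ∘ suc) D) ⟩
    suc (2 * D) + m * suc (2 * D) ∎
    where open ≡-Reasoning

  ∈-ball⁺ : ∀ {m s D y e} (ρ : Fin m → Fin N) i → ∣ e ∣ ≤ D → Disp s (ρ i) y e → y ∈ ball s ρ D
  ∈-ball⁺ {s = s} {e = e} ρ zero ∣e∣≤D ρ₀→y =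
    ∈-++⁺ˡ (subst (_∈ _) (Disp-functional (Disp-translate s (ρ zero) e) ρ₀→y)
                          (∈-map⁺ (translate s (ρ zero)) (∈-symRange⁺ ∣e∣≤D)))
  ∈-ball⁺ ρ (suc i) ∣e∣≤D ρᵢ→y = ∈-++⁺ʳ _ (∈-ball⁺ (ρ ∘ suc) i ∣e∣≤D ρᵢ→y)

  ∈-ball⁻ : ∀ {m s D y} (ρ : Fin m → Fin N) → y ∈ ball s ρ D →
            ∃ λ i → ∃ λ e → ∣ e ∣ ≤ D × Disp s (ρ i) y e
  ∈-ball⁻ {suc m} {s} {D} ρ y∈ with ∈-++⁻ (map (translate s (ρ zero)) (symRange D)) y∈
  ... | inj₁ y∈₀ with ∈-map⁻ (translate s (ρ zero)) y∈₀
  ...   | e , e∈ , refl = zero , e , ∈-symRange⁻ e∈ , Disp-translate s (ρ zero) e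
  ∈-ball⁻ {suc m} ρ y∈ | inj₂ y∈ₛ with ∈-ball⁻ (ρ ∘ suc) y∈ₛ
  ...   | i , e , ∣e∣≤D , ρᵢ→y = suc i , e , ∣e∣≤D , ρᵢ→y

  Jump : ℕ → Fin N → Fin N → Set
  Jump s x y = Disp s x y (+ 1) ⊎ Disp s x y -[1+ 0 ]

  Jump-sym : ∀ {s x y} → Jump s x y → Jump s y x
  Jump-sym (inj₁ x→y) = inj₂ (Disp-sym x→y)
  Jump-sym (inj₂ x→y) = inj₁ (Disp-sym x→y)

  Jump? : ∀ s x y → Dec (Jump s x y)
  Jump? s x y = Disp? s x y (+ 1) ⊎-dec Disp? s x y -[1+ 0 ]

  circulant : ℕ → Graph
  circulant s = simpleGraph N (λ x y → ⌊ Jump? s x y ⌋)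
                              (λ x y → T-⇔⇒≡ (mk⇔ swap swap))
    where
    swap : ∀ {x y} → T ⌊ Jump? s x y ⌋ → T ⌊ Jump? s y x ⌋
    swap = fromWitness ∘ Jump-sym ∘ toWitness

  T-circulant : ∀ {s x y} → T (Graph.adj (circulant s) x y) ⇔ (x ≢ y × Jump s x y)
  T-circulant {s} =
    ⇔.trans (T-offDiagonal {R = λ x y → ⌊ Jump? s x y ⌋}) (⇔.refl ×-⇔ mk⇔ toWitness fromWitness)

  circulant-walk-forward : ∀ {s} .{{_ : NonZero s}} → s < N → ∀ k x →
                           Walk (Graph.adj (circulant s)) everywhere x (translate s x (+ k))
  circulant-walk-forward {s} s<N zero x =
    subst (Walk _ everywhere x) (Disp-functional Disp-refl (Disp-translate s x (+ 0))) (here tt)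
  circulant-walk-forward {s} s<N (suc k) x =
    step tt (from T-circulant (x≢x′ , inj₁ x→x′))
      (subst (Walk _ everywhere x′) x′+k≡x+1+k (circulant-walk-forward s<N k x′))
    where
    x′ : Fin N
    x′ = translate s x (+ 1)
    x→x′ : Disp s x x′ (+ 1)
    x→x′ = Disp-translate s x (+ 1)
    x′+k≡x+1+k : translate s x′ (+ k) ≡ translate s x (+ suc k)
    x′+k≡x+1+k = Disp-functional (Disp-trans x→x′ (Disp-translate s x′ (+ k))) (Disp-translate s x (+ suc k))
    x≢x′ : x ≢ x′
    x≢x′ x≡x′ with Disp-self⇒0 (subst (_< N) (sym (ℕₚ.*-identityʳ s)) s<N)
                               (subst (λ z → Disp s x z (+ 1)) (sym x≡x′) x→x′)
    ... | ()

  circulant-1-connected : 1 < N → Connected (Graph.adj (circulant 1))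
  circulant-1-connected 1<N x y =
    subst (Walk _ everywhere x) (Disp-functional (Disp-translate 1 x (+ k)) x→y)
          (circulant-walk-forward 1<N k x)
    where
    a q : ℤ
    a = ι y ℤ.- ι x
    q = a /ℕ N
    k : ℕ
    k = a %ℕ N
    x→y : Disp 1 x y (+ k)
    x→y = disp (divides q (begin
      a ℤ.- + 1 ℤ.* + k                     ≡⟨ cong (λ b → b ℤ.- + 1 ℤ.* + k) (a≡a%ℕn+[a/ℕn]*n a N) ⟩
      + k ℤ.+ q ℤ.* + N ℤ.- + 1 ℤ.* + k     ≡⟨ cancel (+ k) q (+ N) ⟩
      q ℤ.* + N                             ∎))
      where
      open ≡-Reasoning
      cancel : ∀ K Q M → K ℤ.+ Q ℤ.* M ℤ.- + 1 ℤ.* K ≡ Q ℤ.* M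
      cancel = solve-∀

  Walk⇒Disp : ∀ {s ok x y} → Walk (Graph.adj (circulant s)) ok x y → ∃ (Disp s x y)
  Walk⇒Disp (here _) = + 0 , Disp-refl
  Walk⇒Disp {s} (step _ x-u u⇝y) with proj₂ (to (T-circulant {s}) x-u) | Walk⇒Disp u⇝y
  ... | inj₁ x→u | d , u→y = + 1 ℤ.+ d , Disp-trans x→u u→y
  ... | inj₂ x→u | d , u→y = -[1+ 0 ] ℤ.+ d , Disp-trans x→u u→y

  Disp⇒∣y-x : ∀ {s x y d} → s ℕ∣.∣ N → Disp s x y d → + s ∣ℤ ι y ℤ.- ι x
  Disp⇒∣y-x {s} {x} {y} {d} s∣N (disp N∣gap) =
    subst (+ s ∣ℤ_) (add-back (ι x) (ι y) (+ s) d)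
      (ℤ∣.∣m∣n⇒∣m+n (ℤ∣.∣-trans (ℤ∣.∣ᵤ⇒∣ s∣N) N∣gap) (ℤ∣.∣m⇒∣m*n d (ℤ∣.∣-refl {+ s})))
    where
    add-back : ∀ X Y S D → Y ℤ.- X ℤ.- S ℤ.* D ℤ.+ S ℤ.* D ≡ Y ℤ.- X
    add-back = solve-∀

  circulant-disconnected : ∀ {s} → s ℕ∣.∣ N → 1 < s → ¬ Connected (Graph.adj (circulant s))
  circulant-disconnected {s} s∣N 1<s connected = ℕₚ.<⇒≱ 1<s (ℕ∣.∣⇒≤ (ℤ∣.∣⇒∣ᵤ s∣1))
    where
    1<N : 1 < N
    1<N = ℕₚ.<-≤-trans 1<s (ℕ∣.∣⇒≤ s∣N)
    0<N : 0 < N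
    0<N = ℕₚ.<-trans (s≤s z≤n) 1<N
    s∣1 : + s ∣ℤ + 1
    s∣1 = subst₂ (λ a b → + s ∣ℤ + a ℤ.- + b) (Finₚ.toℕ-fromℕ< 1<N) (Finₚ.toℕ-fromℕ< 0<N)
            (Disp⇒∣y-x s∣N (proj₂ (Walk⇒Disp (connected (fromℕ< 0<N) (fromℕ< 1<N)))))

  -- Counting gives a vertex w more than one jump away from every point of ρ; in the complement it is
  -- adjacent to all of them, so deleting points of ρ leaves the remaining points of ρ connected.
  complement-circulant-walk⇔ : ∀ {s m k} (ρ : Fin m → Fin N) → m * 3 < N →
    (f : Fin k → Fin m) (u t : Fin m) →
    Walk (Graph.adj (complement (circulant s))) (notIn (λ i → ρ (f i))) (ρ u) (ρ t) ⇔
    (T (notIn (λ i → ρ (f i)) (ρ u)) × T (notIn (λ i → ρ (f i)) (ρ t)))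
  complement-circulant-walk⇔ {s} ρ 3m<N f u t = mk⇔ Walk-endpoints
    (λ (ok-u , ok-t) → step ok-u (ρ-w u) (step ok-w (w-ρ t) (here ok-t)))
    where
    G : Graph
    G = complement (circulant s)
    w-fresh : ∃ λ w → w ∉ ball s ρ 1
    w-fresh = fresh (ball s ρ 1) (subst (_< N) (sym (length-ball s ρ 1)) 3m<N)
    w : Fin N
    w = proj₁ w-fresh
    ρ≢w : ∀ i → ρ i ≢ w
    ρ≢w i ρᵢ≡w =
      proj₂ w-fresh (∈-ball⁺ ρ i z≤n (subst (λ y → Disp s (ρ i) y (+ 0)) ρᵢ≡w Disp-refl))
    ¬Jump : ∀ i → ¬ Jump s (ρ i) w
    ¬Jump i (inj₁ ρᵢ→w) = proj₂ w-fresh (∈-ball⁺ ρ i ℕₚ.≤-refl ρᵢ→w)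
    ¬Jump i (inj₂ ρᵢ→w) = proj₂ w-fresh (∈-ball⁺ ρ i ℕₚ.≤-refl ρᵢ→w)
    ρ-w : ∀ i → T (Graph.adj G (ρ i) w)
    ρ-w i = from (T-complement {circulant s}) (ρ≢w i , ¬Jump i ∘ proj₂ ∘ to (T-circulant {s}))
    w-ρ : ∀ i → T (Graph.adj G w (ρ i))
    w-ρ i = subst T (Graph.adj-sym G (ρ i) w) (ρ-w i)
    ok-w : T (notIn (λ i → ρ (f i)) w)
    ok-w = from T-notIn (ρ≢w ∘ f)

  Agree : ∀ {m} → ℕ → ℕ → ℕ → (Fin m → Fin N) → (Fin m → Fin N) → Set
  Agree s s′ D ρ σ = ∀ i j d → ∣ d ∣ ≤ D → Disp s (ρ i) (ρ j) d ⇔ Disp s′ (σ i) (σ j) d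

  module _ {m s s′ D : ℕ} {ρ σ : Fin m → Fin N} where

    Agree-sym : Agree s s′ D ρ σ → Agree s′ s D σ ρ
    Agree-sym agree i j d ∣d∣≤D = ⇔.sym (agree i j d ∣d∣≤D)

    Agree-weaken : ∀ {D′} → D′ ≤ D → Agree s s′ D ρ σ → Agree s s′ D′ ρ σ
    Agree-weaken D′≤D agree i j d ∣d∣≤D′ = agree i j d (ℕₚ.≤-trans ∣d∣≤D′ D′≤D)

    Agree-≡ : Agree s s′ D ρ σ → ∀ i j → (ρ i ≡ ρ j) ⇔ (σ i ≡ σ j)
    Agree-≡ agree i j = ⇔.trans (⇔.sym Disp-0⇔≡) (⇔.trans (agree i j (+ 0) z≤n) Disp-0⇔≡)

    Agree-Jump : 1 ≤ D → Agree s s′ D ρ σ → ∀ i j → Jump s (ρ i) (ρ j) ⇔ Jump s′ (σ i) (σ j)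
    Agree-Jump 1≤D agree i j = agree i j (+ 1) 1≤D ⊎-⇔ agree i j -[1+ 0 ] 1≤D

    Agree-cons : ∀ {v w} → Agree s s′ D ρ σ →
                 (∀ j d → ∣ d ∣ ≤ D → Disp s (ρ j) v d ⇔ Disp s′ (σ j) w d) →
                 (∀ d → ∣ d ∣ ≤ D → Disp s v v d ⇔ Disp s′ w w d) →
                 Agree s s′ D (cons v ρ) (cons w σ)
    Agree-cons agree to-new new-new zero    zero    = new-new
    Agree-cons agree to-new new-new (suc i) zero    = to-new i
    Agree-cons agree to-new new-new zero    (suc j) d ∣d∣≤D =
      ⇔.trans Disp-sym-⇔ (⇔.trans (to-new j (ℤ.- d) ∣-d∣≤D) (⇔.sym Disp-sym-⇔))
      where
      ∣-d∣≤D : ∣ ℤ.- d ∣ ≤ D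
      ∣-d∣≤D = subst (_≤ D) (sym (ℤₚ.∣-i∣≡∣i∣ d)) ∣d∣≤D
    Agree-cons agree to-new new-new (suc i) (suc j) = agree i j

    Agree-adj : 1 ≤ D → Agree s s′ D ρ σ → ∀ i j →
                T (Graph.adj (complement (circulant s)) (ρ i) (ρ j)) ⇔
                T (Graph.adj (complement (circulant s′)) (σ i) (σ j))
    Agree-adj 1≤D agree i j = ⇔.trans (T-complement {circulant s})
      (⇔.trans (≢-⇔ ×-⇔ ¬-cong-⇔ circulant-⇔) (⇔.sym (T-complement {circulant s′})))
      where
      ≢-⇔ : (ρ i ≢ ρ j) ⇔ (σ i ≢ σ j)
      ≢-⇔ = ¬-cong-⇔ (Agree-≡ agree i j)
      circulant-⇔ : T (Graph.adj (circulant s) (ρ i) (ρ j)) ⇔ T (Graph.adj (circulant s′) (σ i) (σ j))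
      circulant-⇔ = ⇔.trans (T-circulant {s})
        (⇔.trans (≢-⇔ ×-⇔ Agree-Jump 1≤D agree i j) (⇔.sym (T-circulant {s′})))

    Agree-notIn : Agree s s′ D ρ σ → ∀ {k} (f : Fin k → Fin m) u →
                  T (notIn (λ i → ρ (f i)) (ρ u)) ⇔ T (notIn (λ i → σ (f i)) (σ u))
    Agree-notIn agree f u = ⇔.trans T-notIn (⇔.trans
      (mk⇔ (λ ρ-avoids i → ρ-avoids i ∘ from (Agree-≡ agree (f i) u))
           (λ σ-avoids i → σ-avoids i ∘ to (Agree-≡ agree (f i) u)))
      (⇔.sym T-notIn))

    Agree-walk : m * 3 < N → Agree s s′ D ρ σ → ∀ {k} (f : Fin k → Fin m) u t →
                 Walk (Graph.adj (complement (circulant s))) (notIn (λ i → ρ (f i))) (ρ u) (ρ t) ⇔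
                 Walk (Graph.adj (complement (circulant s′))) (notIn (λ i → σ (f i))) (σ u) (σ t)
    Agree-walk 3m<N agree f u t = ⇔.trans (complement-circulant-walk⇔ ρ 3m<N f u t)
      (⇔.trans (Agree-notIn agree f u ×-⇔ Agree-notIn agree f t)
               (⇔.sym (complement-circulant-walk⇔ σ 3m<N f u t)))

  -- Halving the radius absorbs the triangle inequality when v is near ρ; when v is far from ρ the only
  -- small self-displacement is 0, on either side, because s·D < N.
  Agree-extend : ∀ {m s s′ D} {ρ σ : Fin m → Fin N} .{{_ : NonZero s}} .{{_ : NonZero s′}} →
                 s * D < N → s′ * D < N → m * suc (2 * D) < N →
                 Agree s s′ (2 * D) ρ σ → ∀ v → ∃ λ w → Agree s s′ D (cons v ρ) (cons w σ)
  Agree-extend {m} {s} {s′} {D} {ρ} {σ} sD<N s′D<N room agree v with v ∈? ball s ρ D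
  ... | yes v∈ = let i , e , ∣e∣≤D , ρᵢ→v = ∈-ball⁻ ρ v∈ in
                 translate s′ (σ i) e ,
                 Agree-cons (Agree-weaken D≤2D agree) (old-new ρᵢ→v ∣e∣≤D) (new-new ρᵢ→v)
    where
    D≤2D : D ≤ 2 * D
    D≤2D = ℕₚ.m≤m+n D (D + 0)
    old-new : ∀ {i e} → Disp s (ρ i) v e → ∣ e ∣ ≤ D →
              ∀ j d → ∣ d ∣ ≤ D → Disp s (ρ j) v d ⇔ Disp s′ (σ j) (translate s′ (σ i) e) d
    old-new {i} {e} ρᵢ→v ∣e∣≤D j d ∣d∣≤D =
      ⇔.trans (Disp-via ρᵢ→v)
        (⇔.trans (agree j i (d ℤ.- e) ∣d-e∣≤2D) (⇔.sym (Disp-via (Disp-translate s′ (σ i) e))))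
      where
      ∣d-e∣≤2D : ∣ d ℤ.- e ∣ ≤ 2 * D
      ∣d-e∣≤2D = ℕₚ.≤-trans (ℤₚ.∣i-j∣≤∣i∣+∣j∣ d e) (ℕₚ.≤-trans (ℕₚ.+-mono-≤ ∣d∣≤D ∣e∣≤D)
                   (ℕₚ.≤-reflexive (cong (λ n → D + n) (sym (ℕₚ.+-identityʳ D)))))
    new-new : ∀ {i e} → Disp s (ρ i) v e → ∀ d → ∣ d ∣ ≤ D →
              Disp s v v d ⇔ Disp s′ (translate s′ (σ i) e) (translate s′ (σ i) e) d
    new-new {i} ρᵢ→v d ∣d∣≤D =
      ⇔.trans Disp-self-⇔ (⇔.trans (agree i i d (ℕₚ.≤-trans ∣d∣≤D D≤2D)) Disp-self-⇔)
  ... | no v∉ = w , Agree-cons (Agree-weaken (ℕₚ.m≤m+n D (D + 0)) agree) old-new new-new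
    where
    w-fresh : ∃ λ w → w ∉ ball s′ σ D
    w-fresh = fresh (ball s′ σ D) (subst (_< N) (sym (length-ball s′ σ D)) room)
    w : Fin N
    w = proj₁ w-fresh
    old-new : ∀ j d → ∣ d ∣ ≤ D → Disp s (ρ j) v d ⇔ Disp s′ (σ j) w d
    old-new j d ∣d∣≤D = mk⇔ (λ ρⱼ→v → ⊥-elim (v∉ (∈-ball⁺ ρ j ∣d∣≤D ρⱼ→v)))
                            (λ σⱼ→w → ⊥-elim (proj₂ w-fresh (∈-ball⁺ σ j ∣d∣≤D σⱼ→w)))
    new-new : ∀ d → ∣ d ∣ ≤ D → Disp s v v d ⇔ Disp s′ w w d
    new-new d ∣d∣≤D = ⇔.trans (Disp-self⇔≡0 (ℕₚ.≤-<-trans (ℕₚ.*-monoʳ-≤ s ∣d∣≤D) sD<N))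
                        (⇔.sym (Disp-self⇔≡0 (ℕₚ.≤-<-trans (ℕₚ.*-monoʳ-≤ s′ ∣d∣≤D) s′D<N)))

module Indistinguishable (N Q s s′ : ℕ) {{_ : NonZero N}} {{_ : NonZero s}} {{_ : NonZero s′}}
                         (s-fits : s * 2 ^ Q < N) (s′-fits : s′ * 2 ^ Q < N)
                         (room : Q * suc (2 * 2 ^ Q) < N) where
  open Circulant N
  open SepEF

  room-at : ∀ {m r} → m ≤ Q → r ≤ Q → m * suc (2 * 2 ^ r) < N
  room-at m≤Q r≤Q = ℕₚ.≤-<-trans (ℕₚ.*-mono-≤ m≤Q (s≤s (ℕₚ.*-monoʳ-≤ 2 (ℕₚ.^-monoʳ-≤ 2 r≤Q)))) room

  fits-at : ∀ t {r} → t * 2 ^ Q < N → r ≤ Q → t * 2 ^ r < N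
  fits-at t t-fits r≤Q = ℕₚ.≤-<-trans (ℕₚ.*-monoʳ-≤ t (ℕₚ.^-monoʳ-≤ 2 r≤Q)) t-fits

  -- With m points placed and r rounds left, the budget m + r ≤ Q keeps every ball used by
  -- Agree-extend smaller than N.
  game : BackAndForth (complement (circulant s)) (complement (circulant s′))
  game = record
    { Related = λ r {m} ρ σ → m + r ≤ Q × Agree s s′ (2 ^ r) ρ σ
    ; equal-⇔ = λ (_ , agree) → Agree-≡ agree
    ; edge-⇔  = λ {r} (_ , agree) → Agree-adj (ℕₚ.m^n>0 2 r) agree
    ; atom-⇔  = λ { {m = m} (m+r≤Q , agree) (conn k u t f) →
                    Agree-walk (room-at (ℕₚ.m+n≤o⇒m≤o m m+r≤Q) z≤n) agree f u t }
    ; forth   = λ {r} {m} (m+r≤Q , agree) v →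
        let w , agree′ = Agree-extend (fits-at s s-fits (r≤Q m+r≤Q)) (fits-at s′ s′-fits (r≤Q m+r≤Q))
                                      (room-at (m≤Q m+r≤Q) (r≤Q m+r≤Q)) agree v
        in w , shift m+r≤Q , agree′
    ; back    = λ {r} {m} (m+r≤Q , agree) w →
        let v , agree′ = Agree-extend (fits-at s′ s′-fits (r≤Q m+r≤Q)) (fits-at s s-fits (r≤Q m+r≤Q))
                                      (room-at (m≤Q m+r≤Q) (r≤Q m+r≤Q)) (Agree-sym agree) w
        in v , shift m+r≤Q , Agree-sym agree′
    }
    where
    m≤Q : ∀ {m r} → m + suc r ≤ Q → m ≤ Q
    m≤Q {m} = ℕₚ.m+n≤o⇒m≤o m
    r≤Q : ∀ {m r} → m + suc r ≤ Q → r ≤ Q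
    r≤Q {m} m+r≤Q = ℕₚ.≤-trans (ℕₚ.n≤1+n _) (ℕₚ.m+n≤o⇒n≤o m m+r≤Q)
    shift : ∀ {m r} → m + suc r ≤ Q → suc m + r ≤ Q
    shift {m} {r} = subst (_≤ Q) (ℕₚ.+-suc m r)

module Witnesses (Q : ℕ) where
  W N : ℕ
  W = suc (2 * 2 ^ Q)
  N = 2 * (suc Q * W)
  open Circulant N

  G₁ G₂ : Graph
  G₁ = complement (circulant 1)
  G₂ = complement (circulant 2)

  fits : ∀ {t} → t ≤ 2 → t * 2 ^ Q < N
  fits t≤2 = ℕₚ.≤-<-trans (ℕₚ.*-monoˡ-≤ (2 ^ Q) t≤2)
               (ℕₚ.≤-trans (ℕₚ.m≤m+n W (Q * W)) (ℕₚ.m≤m+n (suc Q * W) (suc Q * W + 0)))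

  room : Q * W < N
  room = ℕₚ.<-≤-trans (ℕₚ.m<n+m (Q * W) (s≤s z≤n)) (ℕₚ.m≤m+n (suc Q * W) (suc Q * W + 0))

  G₁⇔G₂ : (φ : Sep.Sentence) → SepEF.quantifierRank φ ≤ Q → (G₁ Sep.⊨ φ) ⇔ (G₂ Sep.⊨ φ)
  G₁⇔G₂ φ φ≤Q = SepEF.BackAndForth.Sat-⇔ game (ℕₚ.≤-refl , λ ()) φ φ≤Q
    where open Indistinguishable N Q 1 2 (fits (s≤s z≤n)) (fits ℕₚ.≤-refl) room

  G₁-complement-connected : ComplementConnected G₁
  G₁-complement-connected = from (ComplementConnected-complement (circulant 1))
                                 (circulant-1-connected (ℕₚ.*-monoʳ-≤ 2 (s≤s z≤n)))

  G₂-complement-disconnected : ¬ ComplementConnected G₂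
  G₂-complement-disconnected = circulant-disconnected (ℕ∣.m∣m*n (suc Q * W)) ℕₚ.≤-refl
                               ∘ to (ComplementConnected-complement (circulant 2))

proposition2p7 : Σ Flip.Sentence (λ φ → (G : Graph) → (G Flip.⊨ φ) ⇔ ComplementConnected G)
    × ¬ Σ Sep.Sentence (λ φ → (G : Graph) → (G Sep.⊨ φ) ⇔ ComplementConnected G)
proposition2p7 = (complementConnectedSentence , complementConnectedSentence-correct) , no-separator-sentence
  where
  no-separator-sentence : ¬ Σ Sep.Sentence (λ φ → (G : Graph) → (G Sep.⊨ φ) ⇔ ComplementConnected G)
  no-separator-sentence (φ , φ-defines) =
    G₂-complement-disconnected
      (to (φ-defines G₂) (to (G₁⇔G₂ φ ℕₚ.≤-refl) (from (φ-defines G₁) G₁-complement-connected)))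
    where open Witnesses (SepEF.quantifierRank φ)
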